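{- Let $L:\mathcal U$ be a $\mathcal V$-sup-lattice with basis $\beta:B\to L$ and let $\phi:\mathcal P_{\mathcal U\sqcup\mathcal V^+}(B\times L)$ be a local generator. Suppose that for all $b:B$ the type $b\in\mathcal I_\phi$ is $\mathcal V$-small. Then $\Gamma_\phi$ has a least fixed point: there is $p:L$ with $\Gamma_\phi(p)=p$ such that $p\le x$ for every $x:L$ with $\Gamma_\phi(x)=x$.
   Context: We work in Martin-Löf type theory with non-cumulative universes (successor $\mathcal V^+$, join $\sqcup$), function extensionality, propositional extensionality, propositional truncations ($\exists$), and quotient inductive type families of the form below; no propositional resizing. A type is $\mathcal V$-small if equivalent to a type in $\mathcal V$. $\mathcal P_{\mathcal T}(X):=X\to\Omega_{\mathcal T}$, with $\in$, $\subseteq$, $\mathbb T(S):=\sum_{x:X}x\in S$. A poset: type $P:\mathcal U$ with proposition-valued reflexive antisymmetric transitive $\le:P\to P\to\mathcal W$. A $\mathcal V$-sup-lattice: poset $L:\mathcal U$ where every family indexed by a type in $\mathcal V$ has a join $\bigvee$. A basis: $B:\mathcal V$, $\beta:B\to L$ with (1) each $\beta(b)\le x$ $\mathcal V$-small (write $b\le^B x$ for a chosen equivalent type in $\mathcal V$), (2) each $x$ is the join of $\beta\circ\mathrm{pr}_1$ on $\downarrow^B x:=\sum_b\beta(b)\le x$. Let $\downarrow^B_{\mathcal V}x:=\sum_b b\le^B x$, also a subset in $\mathcal P_{\mathcal V}(B)$. For $U:\mathcal P_{\mathcal V}(B)$, $\bigvee U$ is the join of $\beta\circ\mathrm{pr}_1:\mathbb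 T(U)\to L$ (joins of families indexed by types merely covered by a surjection from, or equivalent to, a type in $\mathcal V$ are taken via reindexing). A generator is $\phi:\mathcal P_{\mathcal U\sqcup\mathcal V^+}(B\times L)$; $S_{\phi,a}:=\sum_{b:B}\exists a':L,(b,a')\in\phi\wedge a'\le a$; $\phi$ is local if every $S_{\phi,a}$ is $\mathcal V$-small, and then $\Gamma_\phi(a):=\bigvee S_{\phi,a}$ (join of $\beta\circ\mathrm{pr}_1$). A subset $S:\mathcal P_{\mathcal T}(B)$ is c-closed if for every $U:\mathcal P_{\mathcal V}(B)$ with $U\subseteq S$, $\downarrow^B_{\mathcal V}\bigvee U\subseteq S$; $\phi$-closed if for all $a:L$, $b:B$ with $(b,a)\in\phi$ and $\downarrow^B a\subseteq S$, $b\in S$. $\mathcal I_\phi:B\to\mathcal U\sqcup\mathcal V^+$ is the quotient inductive family with constructors: each $\mathcal I_\phi(b)$ is a proposition; $\mathcal I_\phi$ is c-closed; $\mathcal I_\phi$ is $\phi$-closed. It satisfies $\mathcal I_\phi\subseteq P$ for every c-closed and $\phi$-closed $P:\mathcal P_{\mathcal T}(B)$. -}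

module Defs where

open import Level using (Level; _⊔_; suc)
open import Agda.Primitive using (Setω)
open import Data.Product using (Σ; _×_; _,_; proj₁; proj₂)
open import Relation.Binary.PropositionalEquality using (_≡_; cong; sym; trans)

isProp : ∀ {ℓ} → Set ℓ → Set ℓ
isProp A = (x y : A) → x ≡ y

-- Ambient axioms of the paper's type theory, taken as hypotheses.
FunExt : Setω
FunExt = ∀ {a b} {A : Set a} {B : A → Set b} {f g : (x : A) → B x}
         → ((x : A) → f x ≡ g x) → f ≡ g

PropExt : Setω
PropExt = ∀ {ℓ} {P Q : Set ℓ} → isProp P → isProp Q → (P → Q) → (Q → P) → P ≡ Q

record PropTrunc : Setω where
  field
    ∥_∥ : ∀ {ℓ} → Set ℓ → Set ℓ
    ∥∥-isProp : ∀ {ℓ} {A : Set ℓ} → isProp ∥ A ∥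
    ∣_∣ : ∀ {ℓ} {A : Set ℓ} → A → ∥ A ∥
    ∥∥-rec : ∀ {ℓ ℓ'} {A : Set ℓ} {P : Set ℓ'} → isProp P → (A → P) → ∥ A ∥ → P

-- Equivalence of types (quasi-inverse data; logically equivalent to
-- bi-invertible maps, so "is-small" below means the same thing).
record _≃_ {a b} (A : Set a) (B : Set b) : Set (a ⊔ b) where
  field
    to : A → B
    from : B → A
    from-to : ∀ x → from (to x) ≡ x
    to-from : ∀ y → to (from y) ≡ y
open _≃_ public

≃-isProp : ∀ {a b} {A : Set a} {B : Set b} → A ≃ B → isProp B → isProp A
≃-isProp e p x y = trans (sym (from-to e x)) (trans (cong (from e) (p (to e x) (to e y))) (from-to e y))

is-small : ∀ {ℓ} (𝓥 : Level) → Set ℓ → Set (suc 𝓥 ⊔ ℓ)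
is-small 𝓥 X = Σ (Set 𝓥) (λ Y → Y ≃ X)

Ω : (𝓣 : Level) → Set (suc 𝓣)
Ω 𝓣 = Σ (Set 𝓣) isProp

𝓟 : ∀ {ℓ} (𝓣 : Level) → Set ℓ → Set (ℓ ⊔ suc 𝓣)
𝓟 𝓣 X = X → Ω 𝓣

_∈_ : ∀ {ℓ 𝓣} {X : Set ℓ} → X → 𝓟 𝓣 X → Set 𝓣
x ∈ S = proj₁ (S x)

_⊆_ : ∀ {ℓ 𝓣 𝓣'} {X : Set ℓ} → 𝓟 𝓣 X → 𝓟 𝓣' X → Set (ℓ ⊔ 𝓣 ⊔ 𝓣')
S ⊆ T = ∀ x → x ∈ S → x ∈ T

𝕋 : ∀ {ℓ 𝓣} {X : Set ℓ} → 𝓟 𝓣 X → Set (ℓ ⊔ 𝓣)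
𝕋 {X = X} S = Σ X (λ x → x ∈ S)

record Poset (𝓤 𝓦 : Level) : Set (suc (𝓤 ⊔ 𝓦)) where
  field
    carrier : Set 𝓤
    _≤_ : carrier → carrier → Set 𝓦
    ≤-isProp : ∀ x y → isProp (x ≤ y)
    ≤-refl : ∀ x → x ≤ x
    ≤-antisym : ∀ {x y} → x ≤ y → y ≤ x → x ≡ y
    ≤-trans : ∀ {x y z} → x ≤ y → y ≤ z → x ≤ z

  is-upper-bound : ∀ {ℓ} {I : Set ℓ} → (I → carrier) → carrier → Set (ℓ ⊔ 𝓦)
  is-upper-bound α x = ∀ i → α i ≤ x

  is-lub : ∀ {ℓ} {I : Set ℓ} → (I → carrier) → carrier → Set (ℓ ⊔ 𝓤 ⊔ 𝓦)
  is-lub α x = is-upper-bound α x × (∀ y → is-upper-bound α y → x ≤ y)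

record SupLattice (𝓥 𝓤 𝓦 : Level) : Set (suc (𝓥 ⊔ 𝓤 ⊔ 𝓦)) where
  field
    poset : Poset 𝓤 𝓦
  open Poset poset public
  field
    ⋁ : {I : Set 𝓥} → (I → carrier) → carrier
    ⋁-is-lub : {I : Set 𝓥} (α : I → carrier) → is-lub α (⋁ α)

record Basis {𝓥 𝓤 𝓦 : Level} (L : SupLattice 𝓥 𝓤 𝓦) : Set (suc 𝓥 ⊔ 𝓤 ⊔ 𝓦) where
  open SupLattice L
  field
    B : Set 𝓥
    β : B → carrier
    -- (1) β b ≤ x is 𝓥-small, witnessed by the chosen type b ≤ᴮ x
    _≤ᴮ_ : B → carrier → Set 𝓥
    ≤ᴮ-≃ : ∀ b x → (b ≤ᴮ x) ≃ (β b ≤ x)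
    ↓-is-lub : ∀ x → is-lub {I = Σ B (λ b → β b ≤ x)} (λ p → β (proj₁ p)) x

module Construction {𝓥 𝓤 𝓦 : Level} (pt : PropTrunc)
                    (L : SupLattice 𝓥 𝓤 𝓦) (Bs : Basis L) where
  open PropTrunc pt
  open SupLattice L
  open Basis Bs

  ↓ᴮ𝓥 : carrier → 𝓟 𝓥 B
  ↓ᴮ𝓥 x b = (b ≤ᴮ x) , ≃-isProp (≤ᴮ-≃ b x) (≤-isProp (β b) x)

  ⋁ᴾ : 𝓟 𝓥 B → carrier
  ⋁ᴾ U = ⋁ {I = 𝕋 U} (λ p → β (proj₁ p))

  Generator : Set (suc 𝓤 ⊔ suc (suc 𝓥))
  Generator = 𝓟 (𝓤 ⊔ suc 𝓥) (B × carrier)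

  S : Generator → carrier → Set (𝓤 ⊔ suc 𝓥 ⊔ 𝓦)
  S φ a = Σ B (λ b → ∥ Σ carrier (λ a' → ((b , a') ∈ φ) × (a' ≤ a)) ∥)

  is-local : Generator → Set (𝓤 ⊔ suc 𝓥 ⊔ 𝓦)
  is-local φ = ∀ a → is-small 𝓥 (S φ a)

  -- Γ_φ(a) := ⋁ S_{φ,a}, the join of β ∘ pr₁ reindexed along the small copy
  Γ : (φ : Generator) → is-local φ → carrier → carrier
  Γ φ loc a = ⋁ {I = proj₁ (loc a)} (λ y → β (proj₁ (to (proj₂ (loc a)) y)))

  c-closed : ∀ {𝓣} → 𝓟 𝓣 B → Set (suc 𝓥 ⊔ 𝓣)
  c-closed P = ∀ (U : 𝓟 𝓥 B) → U ⊆ P → ↓ᴮ𝓥 (⋁ᴾ U) ⊆ P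

  φ-closed : ∀ {𝓣} → Generator → 𝓟 𝓣 B → Set (𝓤 ⊔ suc 𝓥 ⊔ 𝓦 ⊔ 𝓣)
  φ-closed φ P = ∀ (a : carrier) (b : B) → (b , a) ∈ φ
                 → (∀ b' → β b' ≤ a → b' ∈ P) → b ∈ P

  -- I satisfies the constructors and the (propositional) induction principle
  -- of the quotient inductive family 𝓘_φ.
  record Is-𝓘 (φ : Generator) (I : 𝓟 (𝓤 ⊔ suc 𝓥) B) : Setω where
    field
      I-c-closed : c-closed I
      I-φ-closed : φ-closed φ I
      I-ind : ∀ {𝓣} (P : 𝓟 𝓣 B) → c-closed P → φ-closed φ P → I ⊆ P

-- Let p be the join of the basis elements in 𝓘_φ (a small join, by the
-- smallness hypothesis). Since 𝓘_φ is c-closed, 𝓘_φ is exactly the set of basis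
-- elements below p, so φ-closedness of 𝓘_φ makes p a prefixed point: Γ p ≤ p.
-- Conversely, for any prefixed point y the set of basis elements below y is
-- c-closed and φ-closed, so the induction principle gives 𝓘_φ ⊆ ↓ᴮ y, i.e.
-- p ≤ y. As Γ is monotone, Γ p is itself prefixed, whence p ≤ Γ p: p is the
-- least prefixed point, hence the least fixed point (Knaster–Tarski).
module Submission where

open import Defs
open import Level using (Level; suc; _⊔_)
open import Data.Product using (Σ; _×_; _,_; proj₁; proj₂)
open import Relation.Binary.PropositionalEquality using (_≡_; subst)

module GeneratorProperties {𝓥 𝓤 𝓦 : Level} (pt : PropTrunc)
    (L : SupLattice 𝓥 𝓤 𝓦) (Bs : Basis L)
    (φ : Construction.Generator pt L Bs)
    (loc : Construction.is-local pt L Bs φ) where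
  open PropTrunc pt
  open SupLattice L
  open Basis Bs
  open Construction pt L Bs

  ↓β : carrier → 𝓟 𝓦 B
  ↓β y b = (β b ≤ y) , ≤-isProp (β b) y

  ≤-from-basis : ∀ {a y} → (∀ b → β b ≤ a → β b ≤ y) → a ≤ y
  ≤-from-basis {a} {y} f = proj₂ (↓-is-lub a) y (λ q → f (proj₁ q) (proj₂ q))

  ⋁ᴾ-upper : ∀ (U : 𝓟 𝓥 B) b → b ∈ U → β b ≤ ⋁ᴾ U
  ⋁ᴾ-upper U b b∈U = proj₁ (⋁-is-lub {I = 𝕋 U} (λ q → β (proj₁ q))) (b , b∈U)

  ⋁ᴾ-least : ∀ (U : 𝓟 𝓥 B) y → (∀ b → b ∈ U → β b ≤ y) → ⋁ᴾ U ≤ y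
  ⋁ᴾ-least U y f = proj₂ (⋁-is-lub {I = 𝕋 U} (λ q → β (proj₁ q))) y
                     (λ q → f (proj₁ q) (proj₂ q))

  Γ-upper : ∀ y (s : S φ y) → β (proj₁ s) ≤ Γ φ loc y
  Γ-upper y s = subst (λ t → β (proj₁ t) ≤ Γ φ loc y) (to-from e s)
                  (proj₁ (⋁-is-lub (λ w → β (proj₁ (to e w)))) (from e s))
    where e = proj₂ (loc y)

  Γ-least : ∀ y z → (∀ (s : S φ y) → β (proj₁ s) ≤ z) → Γ φ loc y ≤ z
  Γ-least y z f = proj₂ (⋁-is-lub (λ w → β (proj₁ (to e w)))) z (λ w → f (to e w))
    where e = proj₂ (loc y)

  Γ-monotone : ∀ {x y} → x ≤ y → Γ φ loc x ≤ Γ φ loc y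
  Γ-monotone {x} {y} x≤y = Γ-least x (Γ φ loc y) λ (b , t) →
    Γ-upper y (b , ∥∥-rec ∥∥-isProp (λ (a , ba , a≤x) → ∣ a , ba , ≤-trans a≤x x≤y ∣) t)

  ↓β-c-closed : ∀ y → c-closed (↓β y)
  ↓β-c-closed y U U⊆↓y b b≤ᴮ⋁U =
    ≤-trans (to (≤ᴮ-≃ b (⋁ᴾ U)) b≤ᴮ⋁U) (⋁ᴾ-least U y U⊆↓y)

  ↓β-φ-closed : ∀ {y} → Γ φ loc y ≤ y → φ-closed φ (↓β y)
  ↓β-φ-closed {y} Γy≤y a b ba ↓a⊆↓y =
    ≤-trans (Γ-upper y (b , ∣ a , ba , ≤-from-basis ↓a⊆↓y ∣)) Γy≤y

module LeastFixedPoint {𝓥 𝓤 𝓦 : Level} (pt : PropTrunc)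
    (L : SupLattice 𝓥 𝓤 𝓦) (Bs : Basis L)
    (φ : Construction.Generator pt L Bs)
    (loc : Construction.is-local pt L Bs φ)
    (I : 𝓟 (𝓤 ⊔ suc 𝓥) (Basis.B Bs))
    (isI : Construction.Is-𝓘 pt L Bs φ I)
    (I-small : ∀ b → is-small 𝓥 (b ∈ I)) where
  open PropTrunc pt
  open SupLattice L
  open Basis Bs
  open Construction pt L Bs
  open Is-𝓘 isI
  open GeneratorProperties pt L Bs φ loc

  I𝓥 : 𝓟 𝓥 B
  I𝓥 b = proj₁ (I-small b) , ≃-isProp (proj₂ (I-small b)) (proj₂ (I b))

  p : carrier
  p = ⋁ᴾ I𝓥

  ∈I⇒β≤p : ∀ b → b ∈ I → β b ≤ p
  ∈I⇒β≤p b b∈I = ⋁ᴾ-upper I𝓥 b (from (proj₂ (I-small b)) b∈I)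

  β≤p⇒∈I : ∀ b → β b ≤ p → b ∈ I
  β≤p⇒∈I b b≤p =
    I-c-closed I𝓥 (λ b' → to (proj₂ (I-small b'))) b (from (≤ᴮ-≃ b p) b≤p)

  Γp≤p : Γ φ loc p ≤ p
  Γp≤p = Γ-least p p λ (b , t) →
    ∥∥-rec (≤-isProp (β b) p)
      (λ (a , ba , a≤p) → ∈I⇒β≤p b
        (I-φ-closed a b ba (λ b' b'≤a → β≤p⇒∈I b' (≤-trans b'≤a a≤p))))
      t

  p≤prefixed-point : ∀ y → Γ φ loc y ≤ y → p ≤ y
  p≤prefixed-point y Γy≤y = ⋁ᴾ-least I𝓥 y λ b b∈I𝓥 →
    I-ind (↓β y) (↓β-c-closed y) (↓β-φ-closed Γy≤y) b (to (proj₂ (I-small b)) b∈I𝓥)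

  p-fixed : Γ φ loc p ≡ p
  p-fixed = ≤-antisym Γp≤p (p≤prefixed-point (Γ φ loc p) (Γ-monotone Γp≤p))

  p-least : ∀ x → Γ φ loc x ≡ x → p ≤ x
  p-least x Γx≡x = p≤prefixed-point x (subst (Γ φ loc x ≤_) Γx≡x (≤-refl _))

proposition7p4 : {𝓥 𝓤 𝓦 : Level} → FunExt → PropExt → (pt : PropTrunc)
    → (L : SupLattice 𝓥 𝓤 𝓦) → (Bs : Basis L)
    → (φ : Construction.Generator pt L Bs)
    → (loc : Construction.is-local pt L Bs φ)
    → (I : 𝓟 (𝓤 ⊔ suc 𝓥) (Basis.B Bs))
    → Construction.Is-𝓘 pt L Bs φ I
    → (∀ b → is-small 𝓥 (b ∈ I))
    → Σ (SupLattice.carrier L) (λ p →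
        (Construction.Γ pt L Bs φ loc p ≡ p)
        × (∀ x → Construction.Γ pt L Bs φ loc x ≡ x → SupLattice._≤_ L p x))
proposition7p4 _ _ pt L Bs φ loc I isI I-small = p , p-fixed , p-least
  where open LeastFixedPoint pt L Bs φ loc I isI I-small
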